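{- Let $R$ be a commutative ring, $a\in R$ a nilpotent element of nilpotency index $k$, $G$ a group, and $s$ the characteristic of the quotient ring $R/\langle a\rangle$; let $RG$ denote the group ring. Then: (1) If $w$ is a natural number with $\bar x^{\,w}=\bar 1$ for all $\bar x\in ((R/\langle a\rangle)G)^*$, then $x^{w s^{k-1}}=1$ for all $x\in (RG)^*$. (2) If $((R/\langle a\rangle)G)^*$ is finite, then $x^{|((R/\langle a\rangle)G)^*|\, s^{k-1}}=1$ for all $x\in (RG)^*$. (3) If $(RG)^*$ is finite, then $x^{|((R/\langle a\rangle)G)^*|\,|\langle a\rangle|^{|G|}}=1$ for all $x\in (RG)^*$.
   Context: Rings have identity; $S^*$ denotes the group of units of a ring $S$; $\langle a\rangle$ is the ideal generated by $a$. The characteristic of a ring $S$ is the least positive integer $s$ with $s\cdot 1_S=0$. The nilpotency index of $a$ is the least $k$ with $a^k=0$. -}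

module Defs where

open import Level using (Level; _⊔_)
open import Data.Nat using (ℕ; zero; suc; _<_; _≤_)
open import Data.Fin using (Fin)
open import Data.List using (List; []; _∷_; map; concatMap)
open import Data.Product using (Σ; _×_; _,_; ∃)
open import Data.Sum using (_⊎_)
open import Relation.Binary.PropositionalEquality using (_≡_)
open import Relation.Nullary using (¬_)
open import Algebra.Bundles using (CommutativeRing; Group)
open import Algebra.Bundles.Raw using (RawRing)

module RawNotions {c ℓ : Level} (S : RawRing c ℓ) where
  open RawRing S

  pow : Carrier → ℕ → Carrier
  pow x zero    = 1#
  pow x (suc n) = x * pow x n

  natMul1 : ℕ → Carrier
  natMul1 zero    = 0#
  natMul1 (suc n) = 1# + natMul1 n

  IsUnit : Carrier → Set (c ⊔ ℓ)
  IsUnit x = Σ Carrier λ y → (x * y ≈ 1#) × (y * x ≈ 1#)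

  IsCharacteristic : ℕ → Set ℓ
  IsCharacteristic s =
      ((0 < s) × (natMul1 s ≈ 0#) × (∀ t → 0 < t → t < s → ¬ (natMul1 t ≈ 0#)))
    ⊎ ((s ≡ 0) × (∀ t → 0 < t → ¬ (natMul1 t ≈ 0#)))

  IsNilpotencyIndex : Carrier → ℕ → Set ℓ
  IsNilpotencyIndex a k = (pow a k ≈ 0#) × (∀ j → j < k → ¬ (pow a j ≈ 0#))

record HasCard {a p ℓ : Level} {A : Set a} (_≈_ : A → A → Set ℓ)
               (P : A → Set p) (n : ℕ) : Set (a ⊔ p ⊔ ℓ) where
  field
    enum  : Fin n → A
    inP   : ∀ i → P (enum i)
    inj   : ∀ i j → enum i ≈ enum j → i ≡ j
    surj  : ∀ x → P x → ∃ λ i → x ≈ enum i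

-- The group ring SG of a group G over a (raw) ring S: the free S-module on G
-- (finite formal sums Σ r_i g_i, presented as lists of pairs modulo the
-- relations of the free module), with the multiplication extending that of G.

module GroupRing {c ℓ g ℓg : Level} (S : RawRing c ℓ) (G : Group g ℓg) where
  private
    module S = RawRing S
    module G = Group G

  infix 4 _≋_
  infixl 7 _·_

  Elem : Set (c ⊔ g)
  Elem = List (S.Carrier × G.Carrier)

  data _≋_ : Elem → Elem → Set (c ⊔ ℓ ⊔ g ⊔ ℓg) where
    refl≋  : ∀ {xs} → xs ≋ xs
    sym≋   : ∀ {xs ys} → xs ≋ ys → ys ≋ xs
    trans≋ : ∀ {xs ys zs} → xs ≋ ys → ys ≋ zs → xs ≋ zs
    cons≋  : ∀ {p xs ys} → xs ≋ ys → (p ∷ xs) ≋ (p ∷ ys)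
    coeff≋ : ∀ {r r′ x x′ xs} → r S.≈ r′ → x G.≈ x′ →
             ((r , x) ∷ xs) ≋ ((r′ , x′) ∷ xs)
    swap≋  : ∀ {p q xs} → (p ∷ q ∷ xs) ≋ (q ∷ p ∷ xs)
    merge≋ : ∀ {r r′ x xs} → ((r , x) ∷ (r′ , x) ∷ xs) ≋ ((r S.+ r′ , x) ∷ xs)
    zero≋  : ∀ {x xs} → ((S.0# , x) ∷ xs) ≋ xs

  one : Elem
  one = (S.1# , G.ε) ∷ []

  _·_ : Elem → Elem → Elem
  xs · ys = concatMap (λ p → map (λ q → (Data.Product.proj₁ p S.* Data.Product.proj₁ q ,
                                         Data.Product.proj₂ p G.∙ Data.Product.proj₂ q)) ys) xs

  pow : Elem → ℕ → Elem
  pow x zero    = one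
  pow x (suc n) = x · pow x n

  IsUnit : Elem → Set (c ⊔ ℓ ⊔ g ⊔ ℓg)
  IsUnit x = Σ Elem λ y → (x · y ≋ one) × (y · x ≋ one)

  UnitsCard : ℕ → Set (c ⊔ ℓ ⊔ g ⊔ ℓg)
  UnitsCard n = HasCard _≋_ IsUnit n

module _ {c ℓ : Level} (R : CommutativeRing c ℓ) where
  private module R = CommutativeRing R

  -- x ∈ ⟨a⟩  (R commutative, so ⟨a⟩ = Ra)
  InIdeal : R.Carrier → R.Carrier → Set (c ⊔ ℓ)
  InIdeal a x = Σ R.Carrier λ r → x R.≈ (r R.* a)

  Quotient : R.Carrier → RawRing c (c ⊔ ℓ)
  Quotient a = record
    { Carrier = R.Carrier
    ; _≈_     = λ x y → InIdeal a (x R.- y)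
    ; _+_     = R._+_
    ; _*_     = R._*_
    ; -_      = R.-_
    ; 0#      = R.0#
    ; 1#      = R.1#
    }

{-# OPTIONS --safe #-}
-- Reduction modulo ⟨a⟩ maps units of RG to units of (R/⟨a⟩)G, so if x̄ʷ = 1 then xʷ lies in
-- 1 + aRG. On the filtration 1 + aʲRG (j ≥ 1), raising to the s-th power goes one step deeper:
-- (1 + y)ˢ = 1 + s·y + (terms in a²ʲRG), and s·1 ∈ ⟨a⟩. After k − 1 steps we reach
-- 1 + aᵏRG = {1}. Part (2) is part (1) for w = |((R/⟨a⟩)G)*|, by Lagrange's theorem; for (3),
-- xᴺ lies in the group 1 + aRG, which has |⟨a⟩|^|G| elements, and Lagrange applies again.
module Submission where

open import Level using (Level; _⊔_)
open import Function using (_∘_; id)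
open import Function.Definitions using (Injective)
open import Data.Nat using (ℕ; zero; suc)
open import Data.Nat.Divisibility using (_∣_; ∣-refl; ∣m∣n⇒∣m+n; _∣0)
open import Data.Nat.GeneralisedArithmetic using (fold; fold-+)
open import Data.Nat.Induction using (<-wellFounded)
open import Induction.WellFounded using (Acc; acc)
open import Data.Fin using (Fin; toℕ; _≟_; funToFin; finToFun)
open import Data.Fin.Properties using (pigeonhole; funToFin-finToFin; finToFun-funToFin)
open import Data.List using (List; []; _∷_; _++_; [_]; map; length; filter; applyUpTo; allFin)
import Data.List.Properties as List
open import Data.List.Membership.Propositional using (_∈_)
open import Data.List.Membership.Propositional.Properties
  using (∈-filter⁺; ∈-filter⁻; ∈-allFin; ∈-∃++; ∈-++⁻; ∈-++⁺ˡ; ∈-++⁺ʳ; ∈-applyUpTo⁺; ∈-applyUpTo⁻)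
open import Data.List.Relation.Unary.Any using (here; there)
open import Data.List.Relation.Unary.All as All using (All; []; _∷_)
import Data.List.Relation.Unary.All.Properties as All
open import Data.List.Relation.Unary.AllPairs using ([]; _∷_)
open import Data.List.Relation.Unary.Unique.Propositional using (Unique)
open import Data.List.Relation.Unary.Unique.Propositional.Properties using (filter⁺; allFin⁺; applyUpTo⁺₁)
open import Data.List.Relation.Binary.Permutation.Propositional as ↭ using (_↭_; prep; swap; module PermutationReasoning)
import Data.List.Relation.Binary.Permutation.Propositional.Properties as ↭
open import Data.Product using (∃; _×_; _,_; proj₁; proj₂)
open import Data.Sum using (inj₁; inj₂)
open import Data.Empty using (⊥-elim)
open import Data.Unit using (⊤; tt)
open import Relation.Nullary using (¬_; yes; no)
open import Relation.Unary using (Pred; Decidable)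
open import Relation.Unary.Properties using (∁?)
open import Relation.Binary using (IsEquivalence; Setoid)
import Relation.Binary.Reasoning.Setoid as SetoidReasoning
open import Relation.Binary.PropositionalEquality as ≡ using (_≡_; _≢_; cong; subst; subst₂; module ≡-Reasoning)
open import Algebra.Bundles using (Monoid; CommutativeRing; Group)
open import Defs

module _ where
  open import Data.Nat using (pred; _+_; _*_; _∸_; _<_; _≤_; z≤n; s≤s; NonZero; >-nonZero⁻¹)
  open import Data.Nat.Properties
    using ( suc-pred; m<n+m; <-trans; +-suc; m∸n+n≡m; m+[n∸m]≡n; m<n⇒0<n∸m; m∸n≤m; ≤-<-trans; <⇒≤
          ; n<1+n; ≤-antisym)

  least : ∀ {p} {P : Pred ℕ p} → Decidable P → ∀ {n} → P n → ∃ λ d → P d × (∀ j → j < d → ¬ P j)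
  least P? {zero} P0 = 0 , P0 , λ _ ()
  least P? {suc n} Psn with P? 0
  ... | yes P0 = 0 , P0 , λ _ ()
  ... | no ¬P0 with d , Pd , minimal ← least (P? ∘ suc) Psn =
    suc d , Pd , λ { zero _ → ¬P0 ; (suc j) (s≤s j<d) → minimal j j<d }

  module _ {a} {A : Set a} where

    Unique-⊆⇒length≤ : ∀ {xs ys : List A} → Unique xs → (∀ {x} → x ∈ xs → x ∈ ys) → length xs ≤ length ys
    Unique-⊆⇒length≤ {[]} _ _ = z≤n
    Unique-⊆⇒length≤ {x ∷ xs} (x∉xs ∷ xs!) xs⊆ys with us , vs , ≡.refl ← ∈-∃++ (xs⊆ys (here ≡.refl)) =
      subst (length (x ∷ xs) ≤_) (≡.sym length-us++x∷vs) (s≤s (Unique-⊆⇒length≤ xs! xs⊆us++vs))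
      where
        length-us++x∷vs : length (us ++ x ∷ vs) ≡ suc (length (us ++ vs))
        length-us++x∷vs = begin
          length (us ++ x ∷ vs)        ≡⟨ List.length-++ us ⟩
          length us + suc (length vs)  ≡⟨ +-suc (length us) (length vs) ⟩
          suc (length us + length vs)  ≡⟨ cong suc (List.length-++ us) ⟨
          suc (length (us ++ vs))      ∎
          where open ≡-Reasoning
        xs⊆us++vs : ∀ {z} → z ∈ xs → z ∈ us ++ vs
        xs⊆us++vs z∈xs with ∈-++⁻ us (xs⊆ys (there z∈xs))
        ... | inj₁ z∈us         = ∈-++⁺ˡ z∈us
        ... | inj₂ (here ≡.refl)  = ⊥-elim (All.lookup x∉xs z∈xs ≡.refl)
        ... | inj₂ (there z∈vs) = ∈-++⁺ʳ us z∈vs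

    length-filter+length-filter-∁ : ∀ {p} {P : Pred A p} (P? : Decidable P) xs →
      length (filter P? xs) + length (filter (∁? P?) xs) ≡ length xs
    length-filter+length-filter-∁ P? [] = ≡.refl
    length-filter+length-filter-∁ P? (x ∷ xs) with P? x
    ... | yes _ = cong suc (length-filter+length-filter-∁ P? xs)
    ... | no  _ = ≡.trans (+-suc _ _) (cong suc (length-filter+length-filter-∁ P? xs))

  module Iteration {N : ℕ} (f : Fin N → Fin N) (f-injective : Injective _≡_ _≡_ f) where
    open import Data.List.Membership.DecPropositional (_≟_ {N}) using (_∈?_)
    open ≡-Reasoning

    Closed : List (Fin N) → Set
    Closed L = ∀ {x} → x ∈ L → f x ∈ L

    Semiregular : Set
    Semiregular = ∀ j {i i′} → fold i f j ≡ i → fold i′ f j ≡ i′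

    fold-injective : ∀ j → Injective _≡_ _≡_ (λ i → fold i f j)
    fold-injective zero    eq = eq
    fold-injective (suc j) eq = fold-injective j (f-injective eq)

    fold-closed : ∀ {L} → Closed L → ∀ j {i} → i ∈ L → fold i f j ∈ L
    fold-closed closed zero    i∈L = i∈L
    fold-closed closed (suc j) i∈L = closed (fold-closed closed j i∈L)

    ∃-period : ∀ i → ∃ λ d → fold i f (suc d) ≡ i
    ∃-period i with t , t′ , t<t′ , eq ← pigeonhole (n<1+n N) (λ (t : Fin (suc N)) → fold i f (toℕ t)) =
      d , fold-injective (toℕ t) (begin
        fold (fold i f (suc d)) f (toℕ t) ≡⟨ fold-+ i f (toℕ t) {suc d} ⟨
        fold i f (toℕ t + suc d)          ≡⟨ cong (fold i f) (≡.trans (+-suc (toℕ t) d) (m+[n∸m]≡n t<t′)) ⟩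
        fold i f (toℕ t′)                 ≡⟨ eq ⟨
        fold i f (toℕ t)                  ∎)
      where d = toℕ t′ ∸ suc (toℕ t)

    module ExactPeriod (d : ℕ) .{{_ : NonZero d}} (period : ∀ i → fold i f d ≡ i)
                       (aperiodic : ∀ i j → 0 < j → j < d → fold i f j ≢ i) where

      orbit : Fin N → List (Fin N)
      orbit i = applyUpTo (fold i f) d

      orbit-unique : ∀ i → Unique (orbit i)
      orbit-unique i = applyUpTo⁺₁ (fold i f) d λ {j} {j′} j<j′ j′<d eq →
        aperiodic (fold i f j) (j′ ∸ j) (m<n⇒0<n∸m j<j′) (≤-<-trans (m∸n≤m j′ j) j′<d) (begin
          fold (fold i f j) f (j′ ∸ j) ≡⟨ fold-+ i f (j′ ∸ j) ⟨
          fold i f (j′ ∸ j + j)        ≡⟨ cong (fold i f) (m∸n+n≡m (<⇒≤ j<j′)) ⟩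
          fold i f j′                  ≡⟨ eq ⟨
          fold i f j                   ∎)

      orbit-⊆ : ∀ {L i} → Closed L → i ∈ L → ∀ {x} → x ∈ orbit i → x ∈ L
      orbit-⊆ closed i∈L x∈orbit with j , _ , ≡.refl ← ∈-applyUpTo⁻ _ x∈orbit = fold-closed closed j i∈L

      ∈-orbit-f⁻ : ∀ {i x} → f x ∈ orbit i → x ∈ orbit i
      ∈-orbit-f⁻ {i} fx∈orbit with ∈-applyUpTo⁻ (fold i f) fx∈orbit
      ... | zero , _ , fx≡i = subst (_∈ orbit i) (f-injective (begin
              f (fold i f (pred d)) ≡⟨ cong (fold i f) (suc-pred d) ⟩
              fold i f d            ≡⟨ period i ⟩
              i                     ≡⟨ fx≡i ⟨
              _                     ∎)) (∈-applyUpTo⁺ _ (subst (pred d <_) (suc-pred d) (n<1+n (pred d))))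
      ... | suc j , j<d , fx≡ = subst (_∈ orbit i) (≡.sym (f-injective fx≡)) (∈-applyUpTo⁺ _ (<-trans (n<1+n j) j<d))

      d∣length : ∀ L → Unique L → Closed L → d ∣ length L
      d∣length L = go L (<-wellFounded (length L))
        where
        go : ∀ L → Acc _<_ (length L) → Unique L → Closed L → d ∣ length L
        go [] _ _ _ = d ∣0
        go L@(i ∷ _) (acc smaller) L! closed =
          subst (d ∣_) |L| (∣m∣n⇒∣m+n ∣-refl (go outside (smaller |outside|<|L|) outside! outside-closed))
          where
          ∈orbit? = _∈? orbit i
          inside  = filter ∈orbit? L
          outside = filter (∁? ∈orbit?) L
          outside! : Unique outside
          outside! = filter⁺ (∁? ∈orbit?) L!
          |inside| : length inside ≡ d
          |inside| = ≡.trans (≤-antisym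
            (Unique-⊆⇒length≤ (filter⁺ ∈orbit? L!) (proj₂ ∘ ∈-filter⁻ ∈orbit?))
            (Unique-⊆⇒length≤ (orbit-unique i)
              (λ x∈orbit → ∈-filter⁺ ∈orbit? (orbit-⊆ closed (here ≡.refl) x∈orbit) x∈orbit)))
            (List.length-applyUpTo (fold i f) d)
          |L| : d + length outside ≡ length L
          |L| = ≡.trans (cong (_+ length outside) (≡.sym |inside|)) (length-filter+length-filter-∁ ∈orbit? L)
          |outside|<|L| : length outside < length L
          |outside|<|L| = subst (length outside <_) |L| (m<n+m (length outside) (>-nonZero⁻¹ d))
          outside-closed : Closed outside
          outside-closed x∈outside with x∈L , x∉orbit ← ∈-filter⁻ (∁? ∈orbit?) x∈outside =
            ∈-filter⁺ (∁? ∈orbit?) (closed x∈L) (x∉orbit ∘ ∈-orbit-f⁻)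

      d∣N : d ∣ N
      d∣N = subst (d ∣_) (List.length-tabulate id) (d∣length (allFin N) (allFin⁺ N) (λ _ → ∈-allFin _))

      fold-multiple : ∀ q i → fold i f (q * d) ≡ i
      fold-multiple zero    i = ≡.refl
      fold-multiple (suc q) i = begin
        fold i f (d + q * d)        ≡⟨ fold-+ i f d ⟩
        fold (fold i f (q * d)) f d ≡⟨ cong (λ z → fold z f d) (fold-multiple q i) ⟩
        fold i f d                  ≡⟨ period i ⟩
        i                           ∎

    least-period : ∀ i → ∃ λ d → fold i f (suc d) ≡ i × (∀ j → j < d → fold i f (suc j) ≢ i)
    least-period i with D , period ← ∃-period i = least (λ j → fold i f (suc j) ≟ i) {D} period

    semiregular⇒fold-N≡id : Semiregular → ∀ i → fold i f N ≡ i
    semiregular⇒fold-N≡id semiregular i with d , period-i , minimal ← least-period i =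
      subst (λ n → fold i f n ≡ i) (≡.sym (_∣_.equality d∣N)) (fold-multiple (_∣_.quotient d∣N) i)
      where
      period : ∀ i′ → fold i′ f (suc d) ≡ i′
      period _ = semiregular (suc d) period-i
      aperiodic : ∀ i′ j → 0 < j → j < suc d → fold i′ f j ≢ i′
      aperiodic _ (suc j) _ (s≤s j<d) fixed = minimal j j<d (semiregular (suc j) fixed)
      open ExactPeriod (suc d) period aperiodic

module Lagrange {c ℓ} (M : Monoid c ℓ) where
  open Monoid M
  open import Data.Nat using (_+_; _*_)
  open import Data.Nat.Properties using (*-comm)
  open import Algebra.Properties.Monoid M using (cancelˡ; insertˡ; insertʳ; cancelᶜ; elimˡ)
  import Algebra.Properties.Monoid.Mult M as Mult
  open SetoidReasoning setoid

  infixr 8 _^_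
  _^_ : Carrier → ℕ → Carrier
  x ^ n = n Mult.× x

  ^-assocʳ : ∀ x m n → (x ^ m) ^ n ≈ x ^ (m * n)
  ^-assocʳ x m n = trans (Mult.×-assocˡ x n m) (reflexive (cong (x ^_) (*-comm n m)))

  ^-inverseˡ : ∀ {x y} → y ∙ x ≈ ε → ∀ n → y ^ n ∙ x ^ n ≈ ε
  ^-inverseˡ yx≈ε zero    = identityˡ ε
  ^-inverseˡ {x} {y} yx≈ε (suc n) = begin
    y ^ suc n ∙ x ^ suc n       ≈⟨ ∙-congʳ (reflexive (cong (y ^_) (+-comm 1 n))) ⟩
    y ^ (n + 1) ∙ (x ∙ x ^ n)   ≈⟨ ∙-congʳ (trans (Mult.×-homo-+ y n 1) (∙-congˡ (identityʳ y))) ⟩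
    (y ^ n ∙ y) ∙ (x ∙ x ^ n)   ≈⟨ cancelᶜ yx≈ε (y ^ n) (x ^ n) ⟩
    y ^ n ∙ x ^ n               ≈⟨ ^-inverseˡ yx≈ε n ⟩
    ε                           ∎
    where open import Data.Nat.Properties using (+-comm)

  IsUnit : Carrier → Set (c ⊔ ℓ)
  IsUnit x = ∃ λ y → x ∙ y ≈ ε × y ∙ x ≈ ε

  IsUnit-∙ : ∀ {x y} → IsUnit x → IsUnit y → IsUnit (x ∙ y)
  IsUnit-∙ {x} {y} (x′ , xx′≈ε , x′x≈ε) (y′ , yy′≈ε , y′y≈ε) =
    y′ ∙ x′ , trans (cancelᶜ yy′≈ε x x′) xx′≈ε , trans (cancelᶜ x′x≈ε y′ y) y′y≈ε

  -- Left multiplication by x permutes H, and xʲ fixes some h ∈ H iff xʲ ≈ ε (cancel h by a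
  -- right inverse) iff xʲ fixes all of H; so all orbits have the same length, which divides N.
  lagrange : ∀ {p} {H : Carrier → Set p} {N} → HasCard _≈_ H N →
             (∀ {h h′} → H h → H h′ → H (h ∙ h′)) →
             (∀ {h} → H h → ∃ λ h′ → h ∙ h′ ≈ ε) →
             ∀ {x} → H x → (∃ λ x′ → x′ ∙ x ≈ ε) → x ^ N ≈ ε
  lagrange {H = H} {N} card ∙-closed rightInverse {x} x∈H (x′ , x′x≈ε) =
    fixed⇒≈ε {N} (Iteration.semiregular⇒fold-N≡id f f-injective semiregular (index x∈H))
    where
    open HasCard card

    index : ∀ {h} → H h → Fin N
    index h∈H = proj₁ (surj _ h∈H)

    f : Fin N → Fin N
    f i = index (∙-closed x∈H (inP i))

    enum-f : ∀ i → enum (f i) ≈ x ∙ enum i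
    enum-f i = sym (proj₂ (surj _ (∙-closed x∈H (inP i))))

    enum-cong : ∀ {i j} → i ≡ j → enum i ≈ enum j
    enum-cong = reflexive ∘ cong enum

    f-injective : Injective _≡_ _≡_ f
    f-injective {i} {j} fi≡fj = inj i j (begin
      enum i              ≈⟨ insertˡ x′x≈ε (enum i) ⟩
      x′ ∙ (x ∙ enum i)   ≈⟨ ∙-congˡ (enum-f i) ⟨
      x′ ∙ enum (f i)     ≈⟨ ∙-congˡ (enum-cong fi≡fj) ⟩
      x′ ∙ enum (f j)     ≈⟨ ∙-congˡ (enum-f j) ⟩
      x′ ∙ (x ∙ enum j)   ≈⟨ cancelˡ x′x≈ε (enum j) ⟩
      enum j              ∎)

    enum-fold : ∀ j i → enum (fold i f j) ≈ x ^ j ∙ enum i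
    enum-fold zero    i = sym (identityˡ (enum i))
    enum-fold (suc j) i = begin
      enum (f (fold i f j))  ≈⟨ enum-f (fold i f j) ⟩
      x ∙ enum (fold i f j)  ≈⟨ ∙-congˡ (enum-fold j i) ⟩
      x ∙ (x ^ j ∙ enum i)   ≈⟨ assoc x (x ^ j) (enum i) ⟨
      x ^ suc j ∙ enum i     ∎

    fixed⇒≈ε : ∀ {j i} → fold i f j ≡ i → x ^ j ≈ ε
    fixed⇒≈ε {j} {i} fixed with h′ , hh′≈ε ← rightInverse (inP i) = begin
      x ^ j                     ≈⟨ insertʳ hh′≈ε (x ^ j) ⟩
      (x ^ j ∙ enum i) ∙ h′     ≈⟨ ∙-congʳ (enum-fold j i) ⟨
      enum (fold i f j) ∙ h′    ≈⟨ ∙-congʳ (enum-cong fixed) ⟩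
      enum i ∙ h′               ≈⟨ hh′≈ε ⟩
      ε                         ∎

    ≈ε⇒fixed : ∀ {j} i → x ^ j ≈ ε → fold i f j ≡ i
    ≈ε⇒fixed {j} i xʲ≈ε = inj _ _ (trans (enum-fold j i) (elimˡ xʲ≈ε (enum i)))

    semiregular : Iteration.Semiregular f f-injective
    semiregular j {i′ = i′} fixed = ≈ε⇒fixed {j} i′ (fixed⇒≈ε {j} fixed)

module PrincipalIdeal {c ℓ} (R : CommutativeRing c ℓ) where
  open CommutativeRing R
  open import Algebra.Properties.Ring ring using (-‿distribˡ-*; x[y-z]≈xy-xz; [y-z]x≈yx-zx)
  open import Algebra.Properties.Group +-group using (x≈y⇒x∙y⁻¹≈ε)
  open import Algebra.Properties.AbelianGroup +-abelianGroup using (⁻¹-anti-homo‿-; ⁻¹-∙-comm)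
  open import Algebra.Properties.CommutativeSemigroup +-commutativeSemigroup using () renaming (interchange to +-interchange)
  open import Algebra.Properties.CommutativeSemigroup *-commutativeSemigroup using () renaming (interchange to *-interchange)
  open SetoidReasoning setoid

  infix 4 _∈⟨_⟩
  _∈⟨_⟩ : Carrier → Carrier → Set (c ⊔ ℓ)
  x ∈⟨ b ⟩ = InIdeal R b x

  ∈⟨⟩-resp-≈ : ∀ {b x y} → x ≈ y → y ∈⟨ b ⟩ → x ∈⟨ b ⟩
  ∈⟨⟩-resp-≈ x≈y (t , y≈tb) = t , trans x≈y y≈tb

  0∈⟨⟩ : ∀ {b} → 0# ∈⟨ b ⟩
  0∈⟨⟩ {b} = 0# , sym (zeroˡ b)

  +∈⟨⟩ : ∀ {b x y} → x ∈⟨ b ⟩ → y ∈⟨ b ⟩ → x + y ∈⟨ b ⟩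
  +∈⟨⟩ {b} (t , x≈tb) (t′ , y≈t′b) = t + t′ , trans (+-cong x≈tb y≈t′b) (sym (distribʳ b t t′))

  *ˡ∈⟨⟩ : ∀ {b x} r → x ∈⟨ b ⟩ → r * x ∈⟨ b ⟩
  *ˡ∈⟨⟩ {b} r (t , x≈tb) = r * t , trans (*-cong refl x≈tb) (sym (*-assoc r t b))

  *ʳ∈⟨⟩ : ∀ {b x} r → x ∈⟨ b ⟩ → x * r ∈⟨ b ⟩
  *ʳ∈⟨⟩ r x∈ = ∈⟨⟩-resp-≈ (*-comm _ r) (*ˡ∈⟨⟩ r x∈)

  -∈⟨⟩ : ∀ {b x} → x ∈⟨ b ⟩ → - x ∈⟨ b ⟩
  -∈⟨⟩ {b} (t , x≈tb) = - t , trans (-‿cong x≈tb) (-‿distribˡ-* t b)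

  *∈⟨*⟩ : ∀ {b b′ x y} → x ∈⟨ b ⟩ → y ∈⟨ b′ ⟩ → x * y ∈⟨ b * b′ ⟩
  *∈⟨*⟩ {b} {b′} {x} {y} (t , x≈tb) (t′ , y≈t′b′) = t * t′ , (begin
    x * y               ≈⟨ *-cong x≈tb y≈t′b′ ⟩
    (t * b) * (t′ * b′) ≈⟨ *-interchange t b t′ b′ ⟩
    (t * t′) * (b * b′) ∎)

  ∈⟨⟩-resp-generator : ∀ {b b′ x} → b ≈ b′ → x ∈⟨ b ⟩ → x ∈⟨ b′ ⟩
  ∈⟨⟩-resp-generator b≈b′ (t , x≈tb) = t , trans x≈tb (*-congˡ b≈b′)

  ∈⟨*⟩⇒∈⟨⟩ : ∀ {b b′ x} → x ∈⟨ b * b′ ⟩ → x ∈⟨ b′ ⟩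
  ∈⟨*⟩⇒∈⟨⟩ {b} {b′} (t , x≈tbb′) = t * b , trans x≈tbb′ (sym (*-assoc t b b′))

  module _ (a : Carrier) where

    infix 4 _≈ₐ_
    _≈ₐ_ : Carrier → Carrier → Set (c ⊔ ℓ)
    x ≈ₐ y = x - y ∈⟨ a ⟩

    ≈⇒≈ₐ : ∀ {x y} → x ≈ y → x ≈ₐ y
    ≈⇒≈ₐ x≈y = ∈⟨⟩-resp-≈ (x≈y⇒x∙y⁻¹≈ε x≈y) 0∈⟨⟩

    ≈ₐ-sym : ∀ {x y} → x ≈ₐ y → y ≈ₐ x
    ≈ₐ-sym {x} {y} x≈ₐy = ∈⟨⟩-resp-≈ (sym (⁻¹-anti-homo‿- x y)) (-∈⟨⟩ x≈ₐy)

    x-z≈[x-y]+[y-z] : ∀ x y z → x - z ≈ (x - y) + (y - z)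
    x-z≈[x-y]+[y-z] x y z = sym (begin
      (x - y) + (y - z)   ≈⟨ +-assoc x (- y) (y - z) ⟩
      x + (- y + (y - z)) ≈⟨ +-congˡ (+-assoc (- y) y (- z)) ⟨
      x + ((- y + y) - z) ≈⟨ +-congˡ (+-congʳ (-‿inverseˡ y)) ⟩
      x + (0# - z)        ≈⟨ +-congˡ (+-identityˡ (- z)) ⟩
      x - z               ∎)

    ≈ₐ-trans : ∀ {x y z} → x ≈ₐ y → y ≈ₐ z → x ≈ₐ z
    ≈ₐ-trans {x} {y} {z} x≈ₐy y≈ₐz = ∈⟨⟩-resp-≈ (x-z≈[x-y]+[y-z] x y z) (+∈⟨⟩ x≈ₐy y≈ₐz)

    +-congₐ : ∀ {x y u v} → x ≈ₐ y → u ≈ₐ v → x + u ≈ₐ y + v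
    +-congₐ {x} {y} {u} {v} x≈ₐy u≈ₐv = ∈⟨⟩-resp-≈
      (trans (+-congˡ (sym (⁻¹-∙-comm y v))) (+-interchange x u (- y) (- v))) (+∈⟨⟩ x≈ₐy u≈ₐv)

    *-congₐ : ∀ {x y u v} → x ≈ₐ y → u ≈ₐ v → x * u ≈ₐ y * v
    *-congₐ {x} {y} {u} {v} x≈ₐy u≈ₐv = ∈⟨⟩-resp-≈
      (trans (x-z≈[x-y]+[y-z] (x * u) (y * u) (y * v)) (+-cong (sym ([y-z]x≈yx-zx u x y)) (sym (x[y-z]≈xy-xz y u v))))
      (+∈⟨⟩ (*ʳ∈⟨⟩ u x≈ₐy) (*ˡ∈⟨⟩ y u≈ₐv))

    -‿congₐ : ∀ {x y} → x ≈ₐ y → - x ≈ₐ - y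
    -‿congₐ {x} {y} x≈ₐy = ∈⟨⟩-resp-≈ (⁻¹-∙-comm x (- y)) (-∈⟨⟩ x≈ₐy)

    quotientRing : CommutativeRing c (c ⊔ ℓ)
    quotientRing = record
      { Carrier = Carrier ; _≈_ = _≈ₐ_ ; _+_ = _+_ ; _*_ = _*_ ; -_ = -_ ; 0# = 0# ; 1# = 1#
      ; isCommutativeRing = record
        { isRing = record
          { +-isAbelianGroup = record
            { isGroup = record
              { isMonoid = record
                { isSemigroup = record
                  { isMagma = record
                    { isEquivalence = record { refl = ≈⇒≈ₐ refl ; sym = ≈ₐ-sym ; trans = ≈ₐ-trans }
                    ; ∙-cong = +-congₐ }
                  ; assoc = λ x y z → ≈⇒≈ₐ (+-assoc x y z) }
                ; identity = (≈⇒≈ₐ ∘ +-identityˡ) , (≈⇒≈ₐ ∘ +-identityʳ) }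
              ; inverse = (≈⇒≈ₐ ∘ -‿inverseˡ) , (≈⇒≈ₐ ∘ -‿inverseʳ)
              ; ⁻¹-cong = -‿congₐ }
            ; comm = λ x y → ≈⇒≈ₐ (+-comm x y) }
          ; *-cong = *-congₐ
          ; *-assoc = λ x y z → ≈⇒≈ₐ (*-assoc x y z)
          ; *-identity = (≈⇒≈ₐ ∘ *-identityˡ) , (≈⇒≈ₐ ∘ *-identityʳ)
          ; distrib = (λ x y z → ≈⇒≈ₐ (distribˡ x y z)) , (λ x y z → ≈⇒≈ₐ (distribʳ x y z)) }
        ; *-comm = λ x y → ≈⇒≈ₐ (*-comm x y) } }

module GroupRingProperties {c ℓ g ℓg} (S : CommutativeRing c ℓ) (G : Group g ℓg) where
  open import Data.Nat using (_*_)
  open GroupRing (CommutativeRing.rawRing S) G public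
  private
    module S = CommutativeRing S
    module G = Group G

  Term : Set (c ⊔ g)
  Term = S.Carrier × G.Carrier

  infix 4 _≈ₜ_
  _≈ₜ_ : Term → Term → Set (ℓ ⊔ ℓg)
  (r , x) ≈ₜ (r′ , x′) = r S.≈ r′ × x G.≈ x′

  infixl 7 _*ₜ_
  _*ₜ_ : Term → Term → Term
  (r , x) *ₜ (r′ , x′) = r S.* r′ , x G.∙ x′

  ≋-isEquivalence : IsEquivalence _≋_
  ≋-isEquivalence = record { refl = refl≋ ; sym = sym≋ ; trans = trans≋ }

  ≋-setoid : Setoid (c ⊔ g) (c ⊔ ℓ ⊔ g ⊔ ℓg)
  ≋-setoid = record { isEquivalence = ≋-isEquivalence }

  module ≋-Reasoning = SetoidReasoning ≋-setoid

  ≋-reflexive : ∀ {xs ys} → xs ≡ ys → xs ≋ ys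
  ≋-reflexive ≡.refl = refl≋

  ↭⇒≋ : ∀ {xs ys} → xs ↭ ys → xs ≋ ys
  ↭⇒≋ ↭.refl          = refl≋
  ↭⇒≋ (prep _ xs↭ys)  = cons≋ (↭⇒≋ xs↭ys)
  ↭⇒≋ (swap _ _ xs↭ys) = trans≋ swap≋ (cons≋ (cons≋ (↭⇒≋ xs↭ys)))
  ↭⇒≋ (↭.trans p q)   = trans≋ (↭⇒≋ p) (↭⇒≋ q)

  term-cong : ∀ {p q xs} → p ≈ₜ q → p ∷ xs ≋ q ∷ xs
  term-cong (r≈r′ , x≈x′) = coeff≋ r≈r′ x≈x′

  zero-term : ∀ {r x xs} → r S.≈ S.0# → (r , x) ∷ xs ≋ xs
  zero-term r≈0 = trans≋ (coeff≋ r≈0 G.refl) zero≋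

  ++-congˡ : ∀ xs {ys ys′} → ys ≋ ys′ → xs ++ ys ≋ xs ++ ys′
  ++-congˡ []       ys≋ys′ = ys≋ys′
  ++-congˡ (x ∷ xs) ys≋ys′ = cons≋ (++-congˡ xs ys≋ys′)

  ++-congʳ : ∀ {xs xs′} ys → xs ≋ xs′ → xs ++ ys ≋ xs′ ++ ys
  ++-congʳ ys refl≋        = refl≋
  ++-congʳ ys (sym≋ p)     = sym≋ (++-congʳ ys p)
  ++-congʳ ys (trans≋ p q) = trans≋ (++-congʳ ys p) (++-congʳ ys q)
  ++-congʳ ys (cons≋ p)    = cons≋ (++-congʳ ys p)
  ++-congʳ ys (coeff≋ r≈r′ x≈x′) = coeff≋ r≈r′ x≈x′
  ++-congʳ ys swap≋        = swap≋
  ++-congʳ ys merge≋       = merge≋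
  ++-congʳ ys zero≋        = zero≋

  ++-cong : ∀ {xs xs′ ys ys′} → xs ≋ xs′ → ys ≋ ys′ → xs ++ ys ≋ xs′ ++ ys′
  ++-cong {xs′ = xs′} {ys} xs≋xs′ ys≋ys′ = trans≋ (++-congʳ ys xs≋xs′) (++-congˡ xs′ ys≋ys′)

  ++-identityʳ : ∀ xs → xs ++ [] ≋ xs
  ++-identityʳ xs = ≋-reflexive (List.++-identityʳ xs)

  map-cong : ∀ {a} {A : Set a} {f h : A → Term} → (∀ q → f q ≈ₜ h q) → ∀ ys → map f ys ≋ map h ys
  map-cong f≈h []       = refl≋
  map-cong f≈h (q ∷ ys) = trans≋ (term-cong (f≈h q)) (cons≋ (map-cong f≈h ys))

  map-zero : ∀ {a} {A : Set a} {f : A → Term} → (∀ q → proj₁ (f q) S.≈ S.0#) → ∀ ys → map f ys ≋ []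
  map-zero f≈0 []       = refl≋
  map-zero f≈0 (q ∷ ys) = trans≋ (zero-term (f≈0 q)) (map-zero f≈0 ys)

  map-merge : ∀ {a} {A : Set a} {f h k : A → Term} →
              (∀ q → proj₂ (h q) G.≈ proj₂ (f q)) →
              (∀ q → (proj₁ (f q) S.+ proj₁ (h q) , proj₂ (f q)) ≈ₜ k q) →
              ∀ ys → map f ys ++ map h ys ≋ map k ys
  map-merge same-support add []       = refl≋
  map-merge {f = f} {h} same-support add (q ∷ ys) =
    trans≋ (cons≋ (↭⇒≋ (↭.shift (h q) (map f ys) (map h ys))))
   (trans≋ (cons≋ (coeff≋ S.refl (same-support q)))
   (trans≋ merge≋
   (trans≋ (term-cong (add q)) (cons≋ (map-merge same-support add ys)))))

  ·-distribʳ-++ : ∀ xs xs′ ys → (xs ++ xs′) · ys ≡ xs · ys ++ xs′ · ys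
  ·-distribʳ-++ []       xs′ ys = ≡.refl
  ·-distribʳ-++ (p ∷ xs) xs′ ys = ≡.trans (cong (map (p *ₜ_) ys ++_) (·-distribʳ-++ xs xs′ ys))
                                           (≡.sym (List.++-assoc (map (p *ₜ_) ys) (xs · ys) (xs′ · ys)))

  ·-distribˡ-++ : ∀ xs ys ys′ → xs · (ys ++ ys′) ≋ xs · ys ++ xs · ys′
  ·-distribˡ-++ []       ys ys′ = refl≋
  ·-distribˡ-++ (p ∷ xs) ys ys′ =
    trans≋ (++-congˡ (map (p *ₜ_) (ys ++ ys′)) (·-distribˡ-++ xs ys ys′)) (↭⇒≋ (begin
    map (p *ₜ_) (ys ++ ys′) ++ xs · ys ++ xs · ys′       ≡⟨ cong (_++ _) (List.map-++ (p *ₜ_) ys ys′) ⟩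
    (map (p *ₜ_) ys ++ map (p *ₜ_) ys′) ++ xs · ys ++ xs · ys′ ≡⟨ List.++-assoc (map (p *ₜ_) ys) _ _ ⟩
    map (p *ₜ_) ys ++ map (p *ₜ_) ys′ ++ xs · ys ++ xs · ys′
      ↭⟨ ↭.++⁺ˡ (map (p *ₜ_) ys) (↭.shifts (map (p *ₜ_) ys′) (xs · ys)) ⟩
    map (p *ₜ_) ys ++ xs · ys ++ map (p *ₜ_) ys′ ++ xs · ys′   ≡⟨ List.++-assoc (map (p *ₜ_) ys) _ _ ⟨
    (map (p *ₜ_) ys ++ xs · ys) ++ map (p *ₜ_) ys′ ++ xs · ys′ ∎))
    where open PermutationReasoning

  ·-∷ʳ : ∀ xs q ys → xs · (q ∷ ys) ≋ map (_*ₜ q) xs ++ xs · ys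
  ·-∷ʳ xs q ys = trans≋ (·-distribˡ-++ xs [ q ] ys) (++-congʳ (xs · ys) (≋-reflexive (·-[] xs)))
    where
    ·-[] : ∀ xs → xs · [ q ] ≡ map (_*ₜ q) xs
    ·-[] []       = ≡.refl
    ·-[] (p ∷ xs) = cong (p *ₜ q ∷_) (·-[] xs)

  ·-congʳ : ∀ {xs xs′} ys → xs ≋ xs′ → xs · ys ≋ xs′ · ys
  ·-congʳ ys refl≋          = refl≋
  ·-congʳ ys (sym≋ p)       = sym≋ (·-congʳ ys p)
  ·-congʳ ys (trans≋ p q)   = trans≋ (·-congʳ ys p) (·-congʳ ys q)
  ·-congʳ ys (cons≋ {p} xs≋xs′) = ++-congˡ (map (p *ₜ_) ys) (·-congʳ ys xs≋xs′)
  ·-congʳ ys (coeff≋ r≈r′ x≈x′) = ++-congʳ _ (map-cong (λ q → S.*-congʳ r≈r′ , G.∙-congʳ x≈x′) ys)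
  ·-congʳ ys (swap≋ {p} {q} {xs}) = ↭⇒≋ (↭.shifts (map (p *ₜ_) ys) (map (q *ₜ_) ys))
  ·-congʳ ys (merge≋ {r} {r′} {x} {xs}) =
    trans≋ (≋-reflexive (≡.sym (List.++-assoc (map ((r , x) *ₜ_) ys) (map ((r′ , x) *ₜ_) ys) (xs · ys))))
           (++-congʳ (xs · ys) (map-merge (λ _ → G.refl) (λ q → S.sym (S.distribʳ (proj₁ q) r r′) , G.refl) ys))
  ·-congʳ ys (zero≋ {x} {xs}) = ++-congʳ (xs · ys) (map-zero (λ q → S.zeroˡ (proj₁ q)) ys)

  ·-congˡ : ∀ xs {ys ys′} → ys ≋ ys′ → xs · ys ≋ xs · ys′
  ·-congˡ xs refl≋        = refl≋
  ·-congˡ xs (sym≋ p)     = sym≋ (·-congˡ xs p)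
  ·-congˡ xs (trans≋ p q) = trans≋ (·-congˡ xs p) (·-congˡ xs q)
  ·-congˡ xs (cons≋ {q} {ys} {ys′} ys≋ys′) =
    trans≋ (·-∷ʳ xs q ys) (trans≋ (++-congˡ _ (·-congˡ xs ys≋ys′)) (sym≋ (·-∷ʳ xs q ys′)))
  ·-congˡ xs (coeff≋ {xs = ys} r≈r′ x≈x′) =
    trans≋ (·-∷ʳ xs _ ys) (trans≋ (++-congʳ (xs · ys) (map-cong (λ p → S.*-congˡ r≈r′ , G.∙-congˡ x≈x′) xs))
                                  (sym≋ (·-∷ʳ xs _ ys)))
  ·-congˡ xs (swap≋ {q} {q′} {ys}) =
    trans≋ (·-∷ʳ xs q (q′ ∷ ys)) (trans≋ (++-congˡ (map (_*ₜ q) xs) (·-∷ʳ xs q′ ys))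
   (trans≋ (↭⇒≋ (↭.shifts (map (_*ₜ q) xs) (map (_*ₜ q′) xs)))
   (trans≋ (++-congˡ (map (_*ₜ q′) xs) (sym≋ (·-∷ʳ xs q ys))) (sym≋ (·-∷ʳ xs q′ (q ∷ ys))))))
  ·-congˡ xs (merge≋ {r} {r′} {x} {ys}) =
    trans≋ (·-∷ʳ xs _ _) (trans≋ (++-congˡ (map (_*ₜ (r , x)) xs) (·-∷ʳ xs _ ys))
   (trans≋ (≋-reflexive (≡.sym (List.++-assoc (map (_*ₜ (r , x)) xs) (map (_*ₜ (r′ , x)) xs) (xs · ys))))
   (trans≋ (++-congʳ (xs · ys) (map-merge (λ _ → G.refl) (λ p → S.sym (S.distribˡ (proj₁ p) r r′) , G.refl) xs))
           (sym≋ (·-∷ʳ xs _ ys)))))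
  ·-congˡ xs (zero≋ {x} {ys}) =
    trans≋ (·-∷ʳ xs _ ys) (++-congʳ (xs · ys) (map-zero (λ p → S.zeroʳ (proj₁ p)) xs))

  ·-cong : ∀ {xs xs′ ys ys′} → xs ≋ xs′ → ys ≋ ys′ → xs · ys ≋ xs′ · ys′
  ·-cong {xs′ = xs′} {ys} xs≋xs′ ys≋ys′ = trans≋ (·-congʳ ys xs≋xs′) (·-congˡ xs′ ys≋ys′)

  ·-assoc : ∀ xs ys zs → (xs · ys) · zs ≋ xs · (ys · zs)
  ·-assoc []       ys zs = refl≋
  ·-assoc (p ∷ xs) ys zs =
    trans≋ (≋-reflexive (·-distribʳ-++ (map (p *ₜ_) ys) (xs · ys) zs))
           (++-cong (map-·-assoc ys) (·-assoc xs ys zs))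
    where
    map-·-assoc : ∀ ys → map (p *ₜ_) ys · zs ≋ map (p *ₜ_) (ys · zs)
    map-·-assoc []       = refl≋
    map-·-assoc (q ∷ ys) =
      trans≋ (++-cong (map-cong (λ t → S.*-assoc _ _ _ , G.assoc _ _ _) zs) (map-·-assoc ys))
             (≋-reflexive (≡.trans (cong (_++ map (p *ₜ_) (ys · zs)) (List.map-∘ zs))
                                   (≡.sym (List.map-++ (p *ₜ_) (map (q *ₜ_) zs) (ys · zs)))))

  ·-identityˡ : ∀ xs → one · xs ≋ xs
  ·-identityˡ xs = trans≋ (++-identityʳ _)
    (trans≋ (map-cong (λ q → S.*-identityˡ _ , G.identityˡ _) xs) (≋-reflexive (List.map-id xs)))

  ·-identityʳ : ∀ xs → xs · one ≋ xs
  ·-identityʳ []       = refl≋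
  ·-identityʳ (p ∷ xs) = trans≋ (term-cong (S.*-identityʳ _ , G.identityʳ _)) (cons≋ (·-identityʳ xs))

  ·-monoid : Monoid (c ⊔ g) (c ⊔ ℓ ⊔ g ⊔ ℓg)
  ·-monoid = record
    { Carrier = Elem ; _≈_ = _≋_ ; _∙_ = _·_ ; ε = one
    ; isMonoid = record
      { isSemigroup = record
        { isMagma = record { isEquivalence = ≋-isEquivalence ; ∙-cong = ·-cong }
        ; assoc = ·-assoc }
      ; identity = ·-identityˡ , ·-identityʳ } }

  open Lagrange ·-monoid public using (IsUnit-∙; lagrange; ^-assocʳ; ^-inverseˡ) renaming (_^_ to _^ᴳ_)

  pow≡^ᴳ : ∀ u n → pow u n ≡ u ^ᴳ n
  pow≡^ᴳ u zero    = ≡.refl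
  pow≡^ᴳ u (suc n) = cong (u ·_) (pow≡^ᴳ u n)

  pow-* : ∀ u m n → pow u (m * n) ≋ pow (pow u m) n
  pow-* u m n = begin
    pow u (m * n)        ≡⟨ pow≡^ᴳ u (m * n) ⟩
    u ^ᴳ (m * n)         ≈⟨ ^-assocʳ u m n ⟨
    (u ^ᴳ m) ^ᴳ n        ≡⟨ cong (_^ᴳ n) (pow≡^ᴳ u m) ⟨
    (pow u m) ^ᴳ n       ≡⟨ pow≡^ᴳ (pow u m) n ⟨
    pow (pow u m) n      ∎
    where open ≋-Reasoning

  pow-inverseˡ : ∀ {x y} → y · x ≋ one → ∀ n → pow y n · pow x n ≋ one
  pow-inverseˡ {x} {y} yx≋one n =
    subst₂ (λ yⁿ xⁿ → yⁿ · xⁿ ≋ one) (≡.sym (pow≡^ᴳ y n)) (≡.sym (pow≡^ᴳ x n)) (^-inverseˡ yx≋one n)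

  UnitsCard⇒pow≋one : ∀ {N} → UnitsCard N → ∀ {x} → IsUnit x → pow x N ≋ one
  UnitsCard⇒pow≋one {N} card {x} x-unit@(y , _ , yx≋one) =
    trans≋ (≋-reflexive (pow≡^ᴳ x N))
           (lagrange card IsUnit-∙ (λ (h′ , hh′≋one , _) → h′ , hh′≋one) x-unit (y , yx≋one))

  All-· : ∀ {p q t} {P : Term → Set p} {Q : Term → Set q} {T : Term → Set t} →
          (∀ {u v} → P u → Q v → T (u *ₜ v)) →
          ∀ {xs ys} → All P xs → All Q ys → All T (xs · ys)
  All-· P*Q⇒T []        _   = []
  All-· P*Q⇒T (Pu ∷ Pxs) Qys = All.++⁺ (All.map⁺ (All.map (P*Q⇒T Pu) Qys)) (All-· P*Q⇒T Pxs Qys)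

  neg : Elem → Elem
  neg = map (λ (r , x) → S.- r , x)

  ++-inverseʳ : ∀ xs → xs ++ neg xs ≋ []
  ++-inverseʳ xs =
    trans≋ (++-congʳ (neg xs) (≋-reflexive (≡.sym (List.map-id xs))))
   (trans≋ (map-merge {k = λ (_ , x) → S.0# , x} (λ _ → G.refl) (λ (r , _) → S.-‿inverseʳ r , G.refl) xs)
           (map-zero (λ _ → S.refl) xs))

  infixr 7 _⋆_
  _⋆_ : S.Carrier → Elem → Elem
  r ⋆ ys = map (λ (r′ , x) → r S.* r′ , x) ys

  ⋆-distribʳ : ∀ r r′ ys → r ⋆ ys ++ r′ ⋆ ys ≋ (r S.+ r′) ⋆ ys
  ⋆-distribʳ r r′ = map-merge (λ _ → G.refl) (λ (r″ , _) → S.sym (S.distribʳ r″ r r′) , G.refl)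

  ⋆-zeroˡ : ∀ ys → S.0# ⋆ ys ≋ []
  ⋆-zeroˡ = map-zero (λ (r , _) → S.zeroˡ r)

  ⋆-identityˡ : ∀ ys → S.1# ⋆ ys ≋ ys
  ⋆-identityˡ ys = trans≋ (map-cong (λ (r , _) → S.*-identityˡ r , G.refl) ys) (≋-reflexive (List.map-id ys))

  one++-·-one++ : ∀ y y′ → (one ++ y) · (one ++ y′) ≋ one ++ y ++ y′ ++ y · y′
  one++-·-one++ y y′ = begin
    (one ++ y) · (one ++ y′)              ≡⟨ ·-distribʳ-++ one y (one ++ y′) ⟩
    one · (one ++ y′) ++ y · (one ++ y′)  ≈⟨ ++-cong (·-identityˡ (one ++ y′))
                                                     (trans≋ (·-distribˡ-++ y one y′) (++-congʳ (y · y′) (·-identityʳ y))) ⟩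
    (one ++ y′) ++ y ++ y · y′            ≈⟨ cons≋ (↭⇒≋ (↭.shifts y′ y)) ⟩
    one ++ y ++ y′ ++ y · y′              ∎
    where open ≋-Reasoning

module Filtration {c ℓ g ℓg} (R : CommutativeRing c ℓ) (G : Group g ℓg) (a : CommutativeRing.Carrier R) where
  open import Data.Nat using (_+_; _∸_; _≤_; s≤s)
  import Data.Nat as Nat
  open import Data.Nat.Properties using (m∸n+n≡m; m≤n+m; m≤m+n; +-suc; +-identityʳ; m≤n+m∸n)
  open GroupRingProperties R G
  open PrincipalIdeal R
  open CommutativeRing R using (Carrier; _≈_; 0#; semiring)
  private module R = CommutativeRing R
  open import Algebra.Properties.Semiring.Exp semiring using (_^_; ^-homo-*)
  open RawNotions (CommutativeRing.rawRing R) using (natMul1) renaming (pow to powᴿ)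

  powᴿ≡^ : ∀ x n → powᴿ x n ≡ x ^ n
  powᴿ≡^ x zero    = ≡.refl
  powᴿ≡^ x (suc n) = cong (x R.*_) (powᴿ≡^ x n)

  nilpotencyIndex⇒a^k≈0 : ∀ {k} → RawNotions.IsNilpotencyIndex R.rawRing a k → a ^ k ≈ 0#
  nilpotencyIndex⇒a^k≈0 {k} (aᵏ≈0 , _) = R.trans (R.reflexive (≡.sym (powᴿ≡^ a k))) aᵏ≈0

  infix 4 a^_∣_ _≡1-mod-a^_

  -- A record, not a synonym for All, so that j can be inferred from a^ j ∣ z.
  record a^_∣_ (j : ℕ) (z : Elem) : Set (c ⊔ ℓ ⊔ g) where
    constructor coefficients∈
    field coefficients : All (λ (r , _) → r ∈⟨ a ^ j ⟩) z
  open a^_∣_ public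

  ∣-[] : ∀ {j} → a^ j ∣ []
  ∣-[] = coefficients∈ []

  ∣-++ : ∀ {j y z} → a^ j ∣ y → a^ j ∣ z → a^ j ∣ y ++ z
  ∣-++ a∣y a∣z = coefficients∈ (All.++⁺ (coefficients a∣y) (coefficients a∣z))

  ∣-neg : ∀ {j z} → a^ j ∣ z → a^ j ∣ neg z
  ∣-neg a∣z = coefficients∈ (All.map⁺ (All.map -∈⟨⟩ (coefficients a∣z)))

  ∣-⋆ : ∀ {j z} r → a^ j ∣ z → a^ j ∣ r ⋆ z
  ∣-⋆ r a∣z = coefficients∈ (All.map⁺ (All.map (*ˡ∈⟨⟩ r) (coefficients a∣z)))

  ∣-·ʳ : ∀ {j y} w → a^ j ∣ y → a^ j ∣ y · w
  ∣-·ʳ w a∣y = coefficients∈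
    (All-· {Q = λ _ → ⊤} (λ {_} {v} r∈ _ → *ʳ∈⟨⟩ (proj₁ v) r∈)
           (coefficients a∣y) (All.universal (λ _ → tt) w))

  ∣-· : ∀ {i j y z} → a^ i ∣ y → a^ j ∣ z → a^ (i + j) ∣ y · z
  ∣-· {i} {j} a∣y a∣z = coefficients∈ (All-·
    (λ r∈ r′∈ → ∈⟨⟩-resp-generator (R.sym (^-homo-* a i j)) (*∈⟨*⟩ r∈ r′∈))
    (coefficients a∣y) (coefficients a∣z))

  ∣-weaken : ∀ {i j z} → i ≤ j → a^ j ∣ z → a^ i ∣ z
  ∣-weaken {i} {j} i≤j a∣z =
    coefficients∈ (All.map (∈⟨*⟩⇒∈⟨⟩ ∘ ∈⟨⟩-resp-generator a^j≈a^[j∸i]a^i) (coefficients a∣z))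
    where
    a^j≈a^[j∸i]a^i : a ^ j ≈ a ^ (j ∸ i) R.* a ^ i
    a^j≈a^[j∸i]a^i = R.trans (R.reflexive (cong (a ^_) (≡.sym (m∸n+n≡m i≤j)))) (^-homo-* a (j ∸ i) i)

  ∈⟨a⟩⇒∈⟨a^1⟩ : ∀ {r} → r ∈⟨ a ⟩ → r ∈⟨ a ^ 1 ⟩
  ∈⟨a⟩⇒∈⟨a^1⟩ = ∈⟨⟩-resp-generator (R.sym (R.*-identityʳ a))

  ∈⟨a^1⟩⇒∈⟨a⟩ : ∀ {r} → r ∈⟨ a ^ 1 ⟩ → r ∈⟨ a ⟩
  ∈⟨a^1⟩⇒∈⟨a⟩ = ∈⟨⟩-resp-generator (R.*-identityʳ a)

  _≡1-mod-a^_ : Elem → ℕ → Set (c ⊔ ℓ ⊔ g ⊔ ℓg)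
  u ≡1-mod-a^ j = ∃ λ z → a^ j ∣ z × u ≋ one ++ z

  ≡1-resp-≋ : ∀ {j u u′} → u ≋ u′ → u′ ≡1-mod-a^ j → u ≡1-mod-a^ j
  ≡1-resp-≋ u≋u′ (z , a∣z , u′≋) = z , a∣z , trans≋ u≋u′ u′≋

  ≡1-· : ∀ {j u u′} → u ≡1-mod-a^ j → u′ ≡1-mod-a^ j → u · u′ ≡1-mod-a^ j
  ≡1-· (y , a∣y , u≋) (y′ , a∣y′ , u′≋) =
    y ++ y′ ++ y · y′ , ∣-++ a∣y (∣-++ a∣y′ (∣-·ʳ y′ a∣y)) , trans≋ (·-cong u≋ u′≋) (one++-·-one++ y y′)

  2+j≤[1+j]+[1+j] : ∀ j → suc (suc j) ≤ suc j + suc j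
  2+j≤[1+j]+[1+j] j = s≤s (m≤n+m (suc j) j)

  ·-one++neg : ∀ {j u y} → u ≋ one ++ y → a^ suc j ∣ y → u · (one ++ neg y) ≡1-mod-a^ suc (suc j)
  ·-one++neg {j} {u} {y} u≋ a∣y = y · neg y , ∣-weaken (2+j≤[1+j]+[1+j] j) (∣-· a∣y (∣-neg a∣y)) , (begin
    u · (one ++ neg y)                         ≈⟨ ·-congʳ (one ++ neg y) u≋ ⟩
    (one ++ y) · (one ++ neg y)                ≈⟨ one++-·-one++ y (neg y) ⟩
    one ++ y ++ neg y ++ y · neg y             ≡⟨ cong (one ++_) (List.++-assoc y (neg y) _) ⟨
    one ++ (y ++ neg y) ++ y · neg y           ≈⟨ ++-congˡ one (++-congʳ (y · neg y) (++-inverseʳ y)) ⟩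
    one ++ y · neg y                           ∎)
    where open ≋-Reasoning

  pow-expansion : ∀ {j u y} → u ≋ one ++ y → a^ suc j ∣ y →
                  ∀ i → ∃ λ z → a^ suc (suc j) ∣ z × pow u i ≋ one ++ natMul1 i ⋆ y ++ z
  pow-expansion {j} {u} {y} u≋ a∣y zero =
    [] , ∣-[] , cons≋ (sym≋ (trans≋ (++-identityʳ _) (⋆-zeroˡ y)))
  pow-expansion {j} {u} {y} u≋ a∣y (suc i) with z , a∣z , uⁱ≋ ← pow-expansion u≋ a∣y i =
    z ++ y · w , ∣-++ a∣z (∣-weaken (2+j≤[1+j]+[1+j] j) (∣-· a∣y a∣w)) , (begin
      u · pow u i                                ≈⟨ ·-cong u≋ uⁱ≋ ⟩
      (one ++ y) · (one ++ w)                    ≈⟨ one++-·-one++ y w ⟩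
      one ++ y ++ (natMul1 i ⋆ y ++ z) ++ y · w  ≡⟨ cong ((one ++ y) ++_) (List.++-assoc (natMul1 i ⋆ y) z (y · w)) ⟩
      one ++ y ++ natMul1 i ⋆ y ++ z ++ y · w    ≡⟨ cong (one ++_) (List.++-assoc y (natMul1 i ⋆ y) _) ⟨
      one ++ (y ++ natMul1 i ⋆ y) ++ z ++ y · w  ≈⟨ ++-congˡ one (++-congʳ (z ++ y · w) y+iy≋[1+i]y) ⟩
      one ++ natMul1 (suc i) ⋆ y ++ z ++ y · w   ∎)
    where
    open ≋-Reasoning
    w = natMul1 i ⋆ y ++ z
    a∣w : a^ suc j ∣ w
    a∣w = ∣-++ (∣-⋆ (natMul1 i) a∣y) (∣-weaken (n≤1+n (suc j)) a∣z)
      where open import Data.Nat.Properties using (n≤1+n)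
    y+iy≋[1+i]y : y ++ natMul1 i ⋆ y ≋ natMul1 (suc i) ⋆ y
    y+iy≋[1+i]y = trans≋ (++-congʳ (natMul1 i ⋆ y) (sym≋ (⋆-identityˡ y))) (⋆-distribʳ _ (natMul1 i) y)

  module Nilpotent (k : ℕ) (a^k≈0 : a ^ k ≈ 0#) where

    ≡1-mod-a^⇒≋one : ∀ {j u} → k ≤ j → u ≡1-mod-a^ j → u ≋ one
    ≡1-mod-a^⇒≋one k≤j (z , a∣z , u≋) =
      trans≋ u≋ (trans≋ (++-congˡ one (vanish (coefficients (∣-weaken k≤j a∣z)))) (++-identityʳ one))
      where
      vanish : ∀ {z} → All (λ (r , _) → r ∈⟨ a ^ k ⟩) z → z ≋ []
      vanish []                    = refl≋
      vanish ((t , r≈ta^k) ∷ rest) =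
        trans≋ (zero-term (R.trans r≈ta^k (R.trans (R.*-congˡ a^k≈0) (R.zeroʳ t)))) (vanish rest)

    rightInverse : ∀ e {j u} → k ≤ e + suc j → u ≡1-mod-a^ suc j → ∃ λ v → u · v ≋ one
    rightInverse zero    k≤ u≡1 = one , trans≋ (·-identityʳ _) (≡1-mod-a^⇒≋one k≤ u≡1)
    rightInverse (suc e) {j} {u} k≤ (y , a∣y , u≋)
      with v , u[1-y]v≋one ← rightInverse e (subst (k ≤_) (≡.sym (+-suc e (suc j))) k≤) (·-one++neg u≋ a∣y) =
      (one ++ neg y) · v , trans≋ (sym≋ (·-assoc u _ v)) u[1-y]v≋one

    ≡1-rightInverse : ∀ {u} → u ≡1-mod-a^ 1 → ∃ λ v → u · v ≋ one
    ≡1-rightInverse = rightInverse k (m≤m+n k 1)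

    module _ {s : ℕ} (s·1∈⟨a⟩ : natMul1 s ∈⟨ a ⟩) where

      pow-s-≡1 : ∀ {j u} → u ≡1-mod-a^ suc j → pow u s ≡1-mod-a^ suc (suc j)
      pow-s-≡1 (y , a∣y , u≋) with z , a∣z , uˢ≋ ← pow-expansion u≋ a∣y s =
        natMul1 s ⋆ y ++ z , ∣-++ s·1y∈ a∣z , uˢ≋
        where s·1y∈ = coefficients∈ (All.map⁺ (All.map (*∈⟨*⟩ s·1∈⟨a⟩) (coefficients a∣y)))

      pow-s^-≡1 : ∀ e {j u} → u ≡1-mod-a^ suc j → pow u (s Nat.^ e) ≡1-mod-a^ suc j + e
      pow-s^-≡1 zero {j} {u} u≡1 =
        subst (pow u 1 ≡1-mod-a^_) (≡.sym (+-identityʳ (suc j))) (≡1-resp-≋ (·-identityʳ u) u≡1)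
      pow-s^-≡1 (suc e) {j} {u} u≡1 = ≡1-resp-≋ (pow-* u s (s Nat.^ e))
        (subst (pow (pow u s) (s Nat.^ e) ≡1-mod-a^_) (≡.sym (+-suc (suc j) e)) (pow-s^-≡1 e (pow-s-≡1 u≡1)))

      pow-s^[k∸1]≋one : ∀ {u} → u ≡1-mod-a^ 1 → pow u (s Nat.^ (k ∸ 1)) ≋ one
      pow-s^[k∸1]≋one u≡1 = ≡1-mod-a^⇒≋one (m≤n+m∸n k 1) (pow-s^-≡1 (k ∸ 1) u≡1)

module Reduction {c ℓ g ℓg} (R : CommutativeRing c ℓ) (G : Group g ℓg) (a : CommutativeRing.Carrier R) where
  open PrincipalIdeal R
  open GroupRingProperties R G
  open Filtration R G a
  module Q = GroupRingProperties (quotientRing a) G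
  private module R = CommutativeRing R

  ≋⇒≋ₐ : ∀ {u v} → u ≋ v → u Q.≋ v
  ≋⇒≋ₐ refl≋              = Q.refl≋
  ≋⇒≋ₐ (sym≋ p)           = Q.sym≋ (≋⇒≋ₐ p)
  ≋⇒≋ₐ (trans≋ p q)       = Q.trans≋ (≋⇒≋ₐ p) (≋⇒≋ₐ q)
  ≋⇒≋ₐ (cons≋ p)          = Q.cons≋ (≋⇒≋ₐ p)
  ≋⇒≋ₐ (coeff≋ r≈r′ x≈x′) = Q.coeff≋ (≈⇒≈ₐ a r≈r′) x≈x′
  ≋⇒≋ₐ swap≋              = Q.swap≋
  ≋⇒≋ₐ merge≋             = Q.merge≋
  ≋⇒≋ₐ zero≋              = Q.zero≋

  ≋ₐ⇒differ-by-aRG : ∀ {u v} → u Q.≋ v → ∃ λ z → a^ 1 ∣ z × u ≋ v ++ z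
  ≋ₐ⇒differ-by-aRG Q.refl≋ = [] , ∣-[] , sym≋ (++-identityʳ _)
  ≋ₐ⇒differ-by-aRG (Q.sym≋ {u} {v} p) with z , a∣z , u≋v+z ← ≋ₐ⇒differ-by-aRG p =
    neg z , ∣-neg a∣z , (begin
      v                    ≈⟨ ++-identityʳ v ⟨
      v ++ []              ≈⟨ ++-congˡ v (++-inverseʳ z) ⟨
      v ++ z ++ neg z      ≡⟨ List.++-assoc v z (neg z) ⟨
      (v ++ z) ++ neg z    ≈⟨ ++-congʳ (neg z) u≋v+z ⟨
      u ++ neg z           ∎)
    where open ≋-Reasoning
  ≋ₐ⇒differ-by-aRG (Q.trans≋ {zs = w} p q)
    with z , a∣z , u≋v+z ← ≋ₐ⇒differ-by-aRG p | z′ , a∣z′ , v≋w+z′ ← ≋ₐ⇒differ-by-aRG q =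
    z′ ++ z , ∣-++ a∣z′ a∣z ,
    trans≋ u≋v+z (trans≋ (++-congʳ z v≋w+z′) (≋-reflexive (List.++-assoc w z′ z)))
  ≋ₐ⇒differ-by-aRG (Q.cons≋ p) with z , a∣z , u≋v+z ← ≋ₐ⇒differ-by-aRG p = z , a∣z , cons≋ u≋v+z
  ≋ₐ⇒differ-by-aRG (Q.coeff≋ {r} {r′} {x} {x′} {xs} r-r′∈⟨a⟩ x≈x′) =
    [ r R.- r′ , x′ ] , coefficients∈ (∈⟨a⟩⇒∈⟨a^1⟩ r-r′∈⟨a⟩ ∷ []) ,
    sym≋ (trans≋ (cons≋ (↭⇒≋ (↭.++-comm xs _))) (trans≋ merge≋ (coeff≋ r′+[r-r′]≈r (G.sym x≈x′))))
    where
    module G = Group G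
    r′+[r-r′]≈r : r′ R.+ (r R.- r′) R.≈ r
    r′+[r-r′]≈r = R.trans (R.sym (R.+-assoc r′ r (R.- r′))) (xyx⁻¹≈y r′ r)
      where open import Algebra.Properties.AbelianGroup R.+-abelianGroup using (xyx⁻¹≈y)
  ≋ₐ⇒differ-by-aRG Q.swap≋  = [] , ∣-[] , trans≋ swap≋ (sym≋ (++-identityʳ _))
  ≋ₐ⇒differ-by-aRG Q.merge≋ = [] , ∣-[] , trans≋ merge≋ (sym≋ (++-identityʳ _))
  ≋ₐ⇒differ-by-aRG Q.zero≋  = [] , ∣-[] , trans≋ zero≋ (sym≋ (++-identityʳ _))

  powₐ≡pow : ∀ u n → Q.pow u n ≡ pow u n
  powₐ≡pow u zero    = ≡.refl
  powₐ≡pow u (suc n) = cong (u ·_) (powₐ≡pow u n)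

  IsUnit⇒IsUnitₐ : ∀ {u} → IsUnit u → Q.IsUnit u
  IsUnit⇒IsUnitₐ (v , uv≋one , vu≋one) = v , ≋⇒≋ₐ uv≋one , ≋⇒≋ₐ vu≋one

  natMul1ₐ≡natMul1 : ∀ n → RawNotions.natMul1 (Quotient R a) n ≡ RawNotions.natMul1 R.rawRing n
  natMul1ₐ≡natMul1 zero    = ≡.refl
  natMul1ₐ≡natMul1 (suc n) = cong (R.1# R.+_) (natMul1ₐ≡natMul1 n)

  characteristic⇒s·1∈⟨a⟩ : ∀ {s} → RawNotions.IsCharacteristic (Quotient R a) s →
                           RawNotions.natMul1 R.rawRing s ∈⟨ a ⟩
  characteristic⇒s·1∈⟨a⟩ {s} (inj₁ (_ , s·1≈ₐ0 , _)) =
    ∈⟨⟩-resp-≈ x≈x-0 (subst (λ t → t R.- R.0# ∈⟨ a ⟩) (natMul1ₐ≡natMul1 s) s·1≈ₐ0)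
    where
    open import Algebra.Properties.Group R.+-group using (ε⁻¹≈ε)
    x≈x-0 : ∀ {x} → x R.≈ x R.- R.0#
    x≈x-0 {x} = R.sym (R.trans (R.+-congˡ ε⁻¹≈ε) (R.+-identityʳ x))
  characteristic⇒s·1∈⟨a⟩ (inj₂ (≡.refl , _)) = 0∈⟨⟩


module Coefficients {c ℓ g ℓg} (S : CommutativeRing c ℓ) (G : Group g ℓg) {n : ℕ}
                    (G-card : HasCard (Group._≈_ G) (λ _ → ⊤) n) where
  open GroupRingProperties S G
  open import Data.Fin using (zero; suc)
  open import Data.Fin.Properties using (suc-injective; 0≢1+n)
  open import Data.List using (tabulate)
  open import Relation.Nullary using (Dec)
  private
    module S = CommutativeRing S
    module G = Group G
    module Gᶜ = HasCard G-card
  open import Algebra.Properties.CommutativeSemigroup S.+-commutativeSemigroup using (x∙yz≈y∙xz)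

  index : G.Carrier → Fin n
  index x = proj₁ (Gᶜ.surj x tt)

  x≈enum[index[x]] : ∀ x → x G.≈ Gᶜ.enum (index x)
  x≈enum[index[x]] x = proj₂ (Gᶜ.surj x tt)

  index-cong : ∀ {x x′} → x G.≈ x′ → index x ≡ index x′
  index-cong {x} {x′} x≈x′ =
    Gᶜ.inj _ _ (G.trans (G.sym (x≈enum[index[x]] x)) (G.trans x≈x′ (x≈enum[index[x]] x′)))

  index-enum : ∀ i → index (Gᶜ.enum i) ≡ i
  index-enum i = Gᶜ.inj _ _ (G.sym (x≈enum[index[x]] (Gᶜ.enum i)))

  δ : ∀ {i j : Fin n} → Dec (i ≡ j) → S.Carrier → S.Carrier
  δ (yes _) r = r
  δ (no  _) r = S.0#

  δ-yes : ∀ {i j} r → i ≡ j → δ (i ≟ j) r S.≈ r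
  δ-yes {i} {j} r i≡j with i ≟ j
  ... | yes _  = S.refl
  ... | no i≢j = ⊥-elim (i≢j i≡j)

  δ-no : ∀ {i j} r → i ≢ j → δ (i ≟ j) r S.≈ S.0#
  δ-no {i} {j} r i≢j with i ≟ j
  ... | yes i≡j = ⊥-elim (i≢j i≡j)
  ... | no  _   = S.refl

  δ-cong : ∀ {i i′ j r r′} → i ≡ i′ → r S.≈ r′ → δ (i ≟ j) r S.≈ δ (i′ ≟ j) r′
  δ-cong {i} {j = j} ≡.refl r≈r′ with i ≟ j
  ... | yes _ = r≈r′
  ... | no  _ = S.refl

  δ-+ : ∀ {i j} r r′ → δ (i ≟ j) (r S.+ r′) S.≈ δ (i ≟ j) r S.+ δ (i ≟ j) r′
  δ-+ {i} {j} r r′ with i ≟ j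
  ... | yes _ = S.refl
  ... | no  _ = S.sym (S.+-identityˡ S.0#)

  δ-0 : ∀ {i j} → δ (i ≟ j) S.0# S.≈ S.0#
  δ-0 {i} {j} with i ≟ j
  ... | yes _ = S.refl
  ... | no  _ = S.refl

  coefficient : Elem → Fin n → S.Carrier
  coefficient []            i = S.0#
  coefficient ((r , x) ∷ z) i = δ (index x ≟ i) r S.+ coefficient z i

  coefficient-cong : ∀ {u v} → u ≋ v → ∀ i → coefficient u i S.≈ coefficient v i
  coefficient-cong refl≋        i = S.refl
  coefficient-cong (sym≋ p)     i = S.sym (coefficient-cong p i)
  coefficient-cong (trans≋ p q) i = S.trans (coefficient-cong p i) (coefficient-cong q i)
  coefficient-cong (cons≋ p)    i = S.+-congˡ (coefficient-cong p i)
  coefficient-cong (coeff≋ r≈r′ x≈x′) i = S.+-congʳ (δ-cong (index-cong x≈x′) r≈r′)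
  coefficient-cong swap≋        i = x∙yz≈y∙xz _ _ _
  coefficient-cong (merge≋ {r} {r′} {x}) i =
    S.trans (S.sym (S.+-assoc _ _ _)) (S.+-congʳ (S.sym (δ-+ {index x} {i} r r′)))
  coefficient-cong (zero≋ {x}) i = S.trans (S.+-congʳ (δ-0 {index x} {i})) (S.+-identityˡ _)

  terms : ∀ {n′} → (Fin n′ → S.Carrier) → (Fin n′ → G.Carrier) → Elem
  terms v e = tabulate (λ i → v i , e i)

  fromCoefficients : (Fin n → S.Carrier) → Elem
  fromCoefficients v = terms v Gᶜ.enum

  terms-cong : ∀ {n′} {v v′ : Fin n′ → S.Carrier} e → (∀ i → v i S.≈ v′ i) → terms v e ≋ terms v′ e
  terms-cong {zero}   e v≈v′ = refl≋
  terms-cong {suc n′} e v≈v′ = trans≋ (coeff≋ (v≈v′ zero) G.refl) (cons≋ (terms-cong (e ∘ suc) (v≈v′ ∘ suc)))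

  terms-zero : ∀ {n′} {v : Fin n′ → S.Carrier} e → (∀ i → v i S.≈ S.0#) → terms v e ≋ []
  terms-zero {zero}   e v≈0 = refl≋
  terms-zero {suc n′} e v≈0 = trans≋ (zero-term (v≈0 zero)) (terms-zero (e ∘ suc) (v≈0 ∘ suc))

  ∷-terms : ∀ {n′} {v v′ : Fin n′ → S.Carrier} e j r →
            v′ j S.≈ r S.+ v j → (∀ i → i ≢ j → v′ i S.≈ v i) →
            (r , e j) ∷ terms v e ≋ terms v′ e
  ∷-terms {suc n′} e zero    r v′j≈r+vj v′i≈vi =
    trans≋ merge≋ (trans≋ (coeff≋ (S.sym v′j≈r+vj) G.refl)
      (cons≋ (terms-cong (e ∘ suc) (λ i → S.sym (v′i≈vi (suc i) λ ())))))
  ∷-terms {suc n′} e (suc j) r v′j≈r+vj v′i≈vi =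
    trans≋ swap≋ (trans≋ (coeff≋ (S.sym (v′i≈vi zero λ ())) G.refl)
      (cons≋ (∷-terms (e ∘ suc) j r v′j≈r+vj (λ i i≢j → v′i≈vi (suc i) (i≢j ∘ suc-injective)))))

  ≋-fromCoefficients : ∀ z → z ≋ fromCoefficients (coefficient z)
  ≋-fromCoefficients []            = sym≋ (terms-zero Gᶜ.enum (λ _ → S.refl))
  ≋-fromCoefficients ((r , x) ∷ z) =
    trans≋ (cons≋ (≋-fromCoefficients z)) (trans≋ (coeff≋ S.refl (x≈enum[index[x]] x))
      (∷-terms Gᶜ.enum (index x) r (S.+-congʳ (δ-yes {index x} r ≡.refl))
        (λ i i≢x → S.trans (S.+-congʳ (δ-no r (i≢x ∘ ≡.sym))) (S.+-identityˡ _))))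

  coefficient-terms-∉ : ∀ {n′} (v : Fin n′ → S.Carrier) (emb : Fin n′ → Fin n) i →
                        (∀ j → emb j ≢ i) → coefficient (terms v (Gᶜ.enum ∘ emb)) i S.≈ S.0#
  coefficient-terms-∉ {zero}   v emb i i∉ = S.refl
  coefficient-terms-∉ {suc n′} v emb i i∉ =
    S.trans (S.+-cong (δ-no (v zero) (i∉ zero ∘ ≡.trans (≡.sym (index-enum (emb zero)))))
                      (coefficient-terms-∉ (v ∘ suc) (emb ∘ suc) i (i∉ ∘ suc)))
            (S.+-identityˡ S.0#)

  coefficient-terms : ∀ {n′} (v : Fin n′ → S.Carrier) (emb : Fin n′ → Fin n) → Injective _≡_ _≡_ emb →
                      ∀ j → coefficient (terms v (Gᶜ.enum ∘ emb)) (emb j) S.≈ v j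
  coefficient-terms {suc n′} v emb emb-inj zero =
    S.trans (S.+-cong (δ-yes (v zero) (index-enum (emb zero)))
                      (coefficient-terms-∉ (v ∘ suc) (emb ∘ suc) (emb zero) (λ j → 0≢1+n ∘ ≡.sym ∘ emb-inj)))
            (S.+-identityʳ _)
  coefficient-terms {suc n′} v emb emb-inj (suc j) =
    S.trans (S.+-cong (δ-no (v zero) (0≢1+n ∘ emb-inj ∘ ≡.trans (≡.sym (index-enum (emb zero)))))
                      (coefficient-terms (v ∘ suc) (emb ∘ suc) (suc-injective ∘ emb-inj) j))
            (S.+-identityˡ _)

  coefficient-fromCoefficients : ∀ v i → coefficient (fromCoefficients v) i S.≈ v i
  coefficient-fromCoefficients v = coefficient-terms v id id

  fromCoefficients-cong : ∀ {v v′} → (∀ i → v i S.≈ v′ i) → fromCoefficients v ≋ fromCoefficients v′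
  fromCoefficients-cong = terms-cong Gᶜ.enum

  coefficient-closed : ∀ {p} (P : S.Carrier → Set p) → P S.0# → (∀ {r r′} → P r → P r′ → P (r S.+ r′)) →
                       ∀ {z} → All (λ (r , _) → P r) z → ∀ i → P (coefficient z i)
  coefficient-closed P P0 P+ []                          i = P0
  coefficient-closed P P0 P+ {(r , x) ∷ _} (Pr ∷ Pz) i = P+ (Pδ (index x ≟ i)) (coefficient-closed P P0 P+ Pz i)
    where
    Pδ : ∀ {j} (d : Dec (index x ≡ j)) → P (δ d r)
    Pδ (yes _) = Pr
    Pδ (no  _) = P0

funToFin-cong : ∀ {m n} {f g : Fin m → Fin n} → (∀ i → f i ≡ g i) → funToFin f ≡ funToFin g
funToFin-cong {zero}  f≗g = ≡.refl
funToFin-cong {suc m} f≗g = ≡.cong₂ combine (f≗g zero) (funToFin-cong (f≗g ∘ suc))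
  where open import Data.Fin using (zero; suc; combine)

module Cardinality {c ℓ g ℓg} (R : CommutativeRing c ℓ) (G : Group g ℓg) (a : CommutativeRing.Carrier R) where
  open import Data.Nat using (_^_)
  open GroupRingProperties R G
  open PrincipalIdeal R
  open Filtration R G a
  private
    module R = CommutativeRing R
    module G = Group G
  open import Algebra.Properties.Group R.+-group using (∙-cancelˡ)
  open SetoidReasoning R.setoid

  ≡1-mod-a-card : ∀ {m n} → HasCard R._≈_ (InIdeal R a) m → HasCard G._≈_ (λ _ → ⊤) n →
                  HasCard _≋_ (_≡1-mod-a^ 1) (m ^ n)
  ≡1-mod-a-card {m} {n} ⟨a⟩-card G-card = record { enum = E ; inP = E-≡1 ; inj = E-injective ; surj = E-surjective }
    where
    open Coefficients R G G-card
    module Iᶜ = HasCard ⟨a⟩-card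

    E : Fin (m ^ n) → Elem
    E φ = one ++ fromCoefficients (Iᶜ.enum ∘ finToFun φ)

    E-≡1 : ∀ φ → E φ ≡1-mod-a^ 1
    E-≡1 φ = fromCoefficients (Iᶜ.enum ∘ finToFun φ) ,
             coefficients∈ (All.tabulate⁺ (λ i → ∈⟨a⟩⇒∈⟨a^1⟩ (Iᶜ.inP (finToFun φ i)))) , refl≋

    E-injective : ∀ φ ψ → E φ ≋ E ψ → φ ≡ ψ
    E-injective φ ψ Eφ≋Eψ =
      ≡.trans (≡.sym (funToFin-finToFin {n} {m} φ)) (≡.trans (funToFin-cong same) (funToFin-finToFin {n} {m} ψ))
      where
      same : ∀ i → finToFun φ i ≡ finToFun ψ i
      same i = Iᶜ.inj _ _ (begin
        Iᶜ.enum (finToFun φ i)                                   ≈⟨ coefficient-fromCoefficients _ i ⟨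
        coefficient (fromCoefficients (Iᶜ.enum ∘ finToFun φ)) i ≈⟨ ∙-cancelˡ _ _ _ (coefficient-cong Eφ≋Eψ i) ⟩
        coefficient (fromCoefficients (Iᶜ.enum ∘ finToFun ψ)) i ≈⟨ coefficient-fromCoefficients _ i ⟩
        Iᶜ.enum (finToFun ψ i)                                   ∎)

    E-surjective : ∀ u → u ≡1-mod-a^ 1 → ∃ λ φ → u ≋ E φ
    E-surjective u (z , a∣z , u≋one+z) =
      funToFin index∘coefficient ,
      trans≋ u≋one+z (++-congˡ one (trans≋ (≋-fromCoefficients z) (fromCoefficients-cong coefficient≈)))
      where
      coefficient∈⟨a⟩ : ∀ i → coefficient z i ∈⟨ a ⟩
      coefficient∈⟨a⟩ i = ∈⟨a^1⟩⇒∈⟨a⟩ (coefficient-closed _ 0∈⟨⟩ +∈⟨⟩ (coefficients a∣z) i)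
      index∘coefficient : Fin n → Fin m
      index∘coefficient i = proj₁ (Iᶜ.surj _ (coefficient∈⟨a⟩ i))
      coefficient≈ : ∀ i → coefficient z i R.≈ Iᶜ.enum (finToFun (funToFin index∘coefficient) i)
      coefficient≈ i = R.trans (proj₂ (Iᶜ.surj _ (coefficient∈⟨a⟩ i)))
                               (R.reflexive (cong Iᶜ.enum (≡.sym (finToFun-funToFin index∘coefficient i))))

module UnitExponents {c ℓ g ℓg} (R : CommutativeRing c ℓ) (G : Group g ℓg) (a : CommutativeRing.Carrier R)
                     {k : ℕ} (nilpotent : RawNotions.IsNilpotencyIndex (CommutativeRing.rawRing R) a k)
                     {s : ℕ} (characteristic : RawNotions.IsCharacteristic (Quotient R a) s) where
  open import Data.Nat using (_*_; _^_; _∸_)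
  open GroupRingProperties R G
  open Filtration R G a
  open Nilpotent k (nilpotencyIndex⇒a^k≈0 {k} nilpotent)
  open Reduction R G a
  open Cardinality R G a
  private
    module R = CommutativeRing R
    module G = Group G

  Qpow≋one⇒pow≡1 : ∀ w → (∀ x → Q.IsUnit x → Q.pow x w Q.≋ Q.one) → ∀ {x} → IsUnit x → pow x w ≡1-mod-a^ 1
  Qpow≋one⇒pow≡1 w kills-units {x} x-unit =
    ≋ₐ⇒differ-by-aRG (subst (Q._≋ one) (powₐ≡pow x w) (kills-units x (IsUnit⇒IsUnitₐ x-unit)))

  exponent-via-quotient : ∀ w → (∀ x → Q.IsUnit x → Q.pow x w Q.≋ Q.one) →
                          ∀ x → IsUnit x → pow x (w * s ^ (k ∸ 1)) ≋ one
  exponent-via-quotient w kills-units x x-unit =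
    trans≋ (pow-* x w (s ^ (k ∸ 1)))
           (pow-s^[k∸1]≋one (characteristic⇒s·1∈⟨a⟩ characteristic) (Qpow≋one⇒pow≡1 w kills-units x-unit))

  exponent-via-quotient-units : ∀ N → Q.UnitsCard N → ∀ x → IsUnit x → pow x (N * s ^ (k ∸ 1)) ≋ one
  exponent-via-quotient-units N Q-card = exponent-via-quotient N (λ _ → Q.UnitsCard⇒pow≋one Q-card)

  exponent-via-cardinalities : ∀ N m n → Q.UnitsCard N →
                               HasCard R._≈_ (InIdeal R a) m → HasCard G._≈_ (λ _ → ⊤) n →
                               ∀ x → IsUnit x → pow x (N * m ^ n) ≋ one
  exponent-via-cardinalities N m n Q-card ⟨a⟩-card G-card x x-unit@(y , _ , yx≋one) =
    trans≋ (pow-* x N (m ^ n)) (trans≋ (≋-reflexive (pow≡^ᴳ (pow x N) (m ^ n)))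
      (lagrange (≡1-mod-a-card ⟨a⟩-card G-card) ≡1-· ≡1-rightInverse
                (Qpow≋one⇒pow≡1 N (λ _ → Q.UnitsCard⇒pow≋one Q-card) x-unit) (pow y N , pow-inverseˡ yx≋one N)))

open import Data.Nat using (_*_; _^_; _∸_)

corollary4p5 : ∀ {c ℓ g ℓg : Level} (R : CommutativeRing c ℓ) (G : Group g ℓg)
    (a : CommutativeRing.Carrier R) (k : ℕ) →
    RawNotions.IsNilpotencyIndex (CommutativeRing.rawRing R) a k →
    (s : ℕ) → RawNotions.IsCharacteristic (Quotient R a) s →
    -- (1)
    ((w : ℕ) →
      (∀ x → GroupRing.IsUnit (Quotient R a) G x →
        GroupRing._≋_ (Quotient R a) G (GroupRing.pow (Quotient R a) G x w) (GroupRing.one (Quotient R a) G)) →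
      ∀ x → GroupRing.IsUnit (CommutativeRing.rawRing R) G x →
        GroupRing._≋_ (CommutativeRing.rawRing R) G
          (GroupRing.pow (CommutativeRing.rawRing R) G x (w * s ^ (k ∸ 1)))
          (GroupRing.one (CommutativeRing.rawRing R) G))
    × -- (2)
    ((N : ℕ) → GroupRing.UnitsCard (Quotient R a) G N →
      ∀ x → GroupRing.IsUnit (CommutativeRing.rawRing R) G x →
        GroupRing._≋_ (CommutativeRing.rawRing R) G
          (GroupRing.pow (CommutativeRing.rawRing R) G x (N * s ^ (k ∸ 1)))
          (GroupRing.one (CommutativeRing.rawRing R) G))
    × -- (3)
    ((M N m n : ℕ) → GroupRing.UnitsCard (CommutativeRing.rawRing R) G M →
      GroupRing.UnitsCard (Quotient R a) G N →
      HasCard (CommutativeRing._≈_ R) (InIdeal R a) m →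
      HasCard (Group._≈_ G) (λ _ → ⊤) n →
      ∀ x → GroupRing.IsUnit (CommutativeRing.rawRing R) G x →
        GroupRing._≋_ (CommutativeRing.rawRing R) G
          (GroupRing.pow (CommutativeRing.rawRing R) G x (N * m ^ n))
          (GroupRing.one (CommutativeRing.rawRing R) G))
corollary4p5 R G a k nilpotent s characteristic =
  exponent-via-quotient , exponent-via-quotient-units , λ _ N m n _ → exponent-via-cardinalities N m n
  where
  open UnitExponents R G a nilpotent characteristic
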